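{- Let $A=\{0,1,\dots,m\}$ with $m\ge 1$, let $n\ge 7$, let $\ell=2n+1$, and let $u=m(m-1)m^{n-2}$ (a word of length $n$). Then the number of Nyldon words over $A$ of length at most $\ell$ that are lexicographically greater than $u$ equals $$\frac{|A|^{n+2}-|A|}{|A|-1}-\left(|A|^3+|A|^2+2|A|+2\right).$$
   Context: $A=\{0,1,\dots,m\}$ is ordered $0<1<\cdots<m$, and $|A|=m+1$. The lexicographic order $<_{\text{lex}}$ on $A^*$: $u<_{\text{lex}}v$ if $u$ is a proper prefix of $v$, or there are a word $p$ and letters $i<j$ with $pi$ a prefix of $u$ and $pj$ a prefix of $v$. Nyldon words are defined recursively: a nonempty word $w$ is Nyldon if $w$ is a single letter, or $w$ cannot be written as $w=w_1w_2\cdots w_k$ with $k\ge 2$, each $w_i$ Nyldon, and $w_1\le_{\text{lex}}w_2\le_{\text{lex}}\cdots\le_{\text{lex}}w_k$. $m^{r}$ denotes $r$ copies of the letter $m$. -}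

module Defs where

open import Data.Nat using (ℕ; zero; suc; _<ᵇ_; _≡ᵇ_; _+_; _∸_)
open import Data.Bool using (Bool; true; false; _∧_; _∨_; not; T)
open import Data.List using (List; []; _∷_; map; concatMap; upTo; length; filter)
open import Data.Bool.ListAction using (any; all)
open import Relation.Nullary.Decidable using (T?)

-- Letters of A = {0,1,...,m} are represented by natural numbers; words are lists.
Word : Set
Word = List ℕ

eqW : Word → Word → Bool
eqW []       []       = true
eqW []       (_ ∷ _)  = false
eqW (_ ∷ _)  []       = false
eqW (a ∷ u)  (b ∷ v)  = (a ≡ᵇ b) ∧ eqW u v

lexLt : Word → Word → Bool
lexLt []       []       = false
lexLt []       (_ ∷ _)  = true
lexLt (_ ∷ _)  []       = false
lexLt (a ∷ u)  (b ∷ v)  = (a <ᵇ b) ∨ ((a ≡ᵇ b) ∧ lexLt u v)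

lexLe : Word → Word → Bool
lexLe u v = lexLt u v ∨ eqW u v

nondecr : List Word → Bool
nondecr []            = true
nondecr (_ ∷ [])      = true
nondecr (u ∷ v ∷ ws)  = lexLe u v ∧ nondecr (v ∷ ws)

factorizations : Word → List (List Word)
factorizations []      = [] ∷ []
factorizations (a ∷ w) = concatMap step (factorizations w)
  where
  step : List Word → List (List Word)
  step []       = ((a ∷ []) ∷ []) ∷ []
  step (p ∷ ps) = ((a ∷ p) ∷ ps) ∷ ((a ∷ []) ∷ p ∷ ps) ∷ []

atLeastTwo : List Word → Bool
atLeastTwo (_ ∷ _ ∷ _) = true
atLeastTwo _           = false

-- Nyldon predicate with fuel; each factor in a factorization with k ≥ 2 is a
-- proper factor, hence shorter, so fuel = length w is enough.
nyldonF : ℕ → Word → Bool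
nyldonF zero    _            = false
nyldonF (suc f) []           = false
nyldonF (suc f) (_ ∷ [])     = true
nyldonF (suc f) w@(_ ∷ _ ∷ _) =
  not (any (λ fs → atLeastTwo fs ∧ (all (nyldonF f) fs ∧ nondecr fs)) (factorizations w))

isNyldon : Word → Bool
isNyldon w = nyldonF (length w) w

wordsOfLength : ℕ → ℕ → List Word
wordsOfLength N zero    = [] ∷ []
wordsOfLength N (suc k) = concatMap (λ a → map (a ∷_) (wordsOfLength N k)) (upTo N)

wordsUpTo : ℕ → ℕ → List Word
wordsUpTo N ℓ = concatMap (wordsOfLength N) (upTo (suc ℓ))

countNyldonAbove : (m ℓ : ℕ) → Word → ℕ
countNyldonAbove m ℓ u =
  length (filter (λ w → T? (isNyldon w ∧ lexLt u w)) (wordsUpTo (suc m) ℓ))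

-- A word starting with m m is never Nyldon, so a Nyldon word over {0, …, m} that is
-- lexicographically above u = m (m−1) mⁿ⁻² is u x with x nonempty (and |x| ≤ n + 1 here).
-- Comparing the first two factors of a nondecreasing Nyldon factorization of u x shows that
-- u x can fail to be Nyldon only by starting with v v, where v = m (m−1) mⁿ⁻³, or with u u;
-- conversely v v z = (v)(v z) and u u z = (u)(u z) are such factorizations when z is short.
-- So the count is that of proper extensions of u of length ≤ 2n + 1, (m+1) + ⋯ + (m+1)ⁿ⁺¹,
-- minus the extensions of v v, 1 + ⋯ + (m+1)³, and of u u, 1 + (m+1).
module Submission where

open import Defs
open import Data.Nat using (ℕ; zero; suc; _+_; _*_; _∸_; _^_; _≤_; _<_; _<ᵇ_; _≡ᵇ_; z≤n; s≤s; NonZero; >-nonZero)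
open import Data.Nat.DivMod using (_/_; m*n/n≡m)
open import Data.Nat.Tactic.RingSolver using (solve-∀)
open import Data.Nat.Properties
open import Data.Bool using (Bool; true; false; _∧_; not; T)
open import Data.Bool.Properties using (T-≡; T-∧; T-∨)
open import Data.Bool.ListAction using (any; all; and; or)
open import Data.List using (List; []; _∷_; _++_; [_]; map; concat; concatMap; filter; applyUpTo; length; replicate)
open import Data.List.Properties
  using (length-++; length-++-≤ˡ; length-++-≤ʳ; filter-++; length-replicate; ++-identityʳ; ++-assoc; ++-cancelˡ;
         ∷-injective; ∷-injectiveˡ; ∷-injectiveʳ; map-cong-local)
open import Data.List.Relation.Unary.All as All using (All; []; _∷_)
open import Data.List.Relation.Unary.Any using (here; there)
import Data.List.Relation.Unary.Any.Properties as Any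
import Data.List.Relation.Unary.All.Properties as All
open import Data.List.Membership.Propositional using (_∈_; find; lose)
open import Data.List.Membership.Propositional.Properties using (∈-concatMap⁺; ∈-concatMap⁻)
open import Data.Product as Product using (∃-syntax; _×_; _,_; proj₁; proj₂)
open import Data.Sum as Sum using (_⊎_; inj₁; inj₂)
open import Data.Empty using (⊥-elim)
open import Function using (_∘_; id; flip; Equivalence)
open import Relation.Nullary using (¬_; yes; no)
open import Relation.Nullary.Decidable using (T?; decidable-stable)
open import Relation.Binary.PropositionalEquality
  using (_≡_; _≢_; refl; sym; trans; cong; cong₂; subst; module ≡-Reasoning)

-- Nondecreasing Nyldon factorizations

data NonEmpty : Word → Set where
  nonEmpty : ∀ {a w} → NonEmpty (a ∷ w)

nonEmpty-length : ∀ {w} → NonEmpty w → 1 ≤ length w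
nonEmpty-length nonEmpty = s≤s z≤n

factorizations-sound : ∀ w {fs} → fs ∈ factorizations w → concat fs ≡ w × All NonEmpty fs
factorizations-sound []      (here refl) = refl , []
factorizations-sound (a ∷ w) fs∈ with find (∈-concatMap⁻ _ {factorizations w} fs∈)
... | [] , gs∈ , here refl with factorizations-sound w gs∈
...   | refl , _ = refl , nonEmpty ∷ []
factorizations-sound (a ∷ w) fs∈ | p ∷ ps , gs∈ , here refl with factorizations-sound w gs∈
...   | refl , _ ∷ ne = refl , nonEmpty ∷ ne
factorizations-sound (a ∷ w) fs∈ | p ∷ ps , gs∈ , there (here refl) with factorizations-sound w gs∈
...   | refl , ne = refl , nonEmpty ∷ ne

factorizations-complete : ∀ w fs → concat fs ≡ w → All NonEmpty fs → fs ∈ factorizations w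
factorizations-complete []      []                    refl []             = here refl
factorizations-complete []      (_ ∷ _)               ()   (nonEmpty ∷ _)
factorizations-complete (a ∷ w) ((a ∷ []) ∷ [])       refl _              = here refl
factorizations-complete (a ∷ w) ((a ∷ []) ∷ g ∷ gs)   refl (_ ∷ ne)       =
  ∈-concatMap⁺ _ (lose (factorizations-complete w (g ∷ gs) refl ne) (there (here refl)))
factorizations-complete (a ∷ w) ((a ∷ b ∷ g) ∷ gs)    refl (_ ∷ ne)       =
  ∈-concatMap⁺ _ (lose (factorizations-complete w ((b ∷ g) ∷ gs) refl (nonEmpty ∷ ne)) (here refl))

∈-concat-length : ∀ {g : Word} {gs} → g ∈ gs → length g ≤ length (concat gs)
∈-concat-length {g = g}           (here refl) = length-++-≤ˡ g
∈-concat-length {gs = h ∷ gs} (there g∈)  = ≤-trans (∈-concat-length g∈) (length-++-≤ʳ (concat gs) {h})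

proper-factor-shorter : ∀ {g g₁ g₂ : Word} {gs} → All NonEmpty (g₁ ∷ g₂ ∷ gs) →
                        g ∈ g₁ ∷ g₂ ∷ gs → length g < length (concat (g₁ ∷ g₂ ∷ gs))
proper-factor-shorter {g₁ = g₁} {g₂} {gs} (_ ∷ ne₂ ∷ _) (here refl) =
  subst (length g₁ <_) (sym (length-++ g₁))
    (m<m+n _ (≤-trans (nonEmpty-length ne₂) (∈-concat-length {gs = g₂ ∷ gs} (here refl))))
proper-factor-shorter {g₁ = g₁} (ne₁ ∷ _) (there g∈) =
  subst (_ <_) (sym (length-++ g₁)) (≤-<-trans (∈-concat-length g∈) (m<n+m _ (nonEmpty-length ne₁)))

factor-shorter : ∀ {w g g₁ g₂ : Word} {gs} → (g₁ ∷ g₂ ∷ gs) ∈ factorizations w →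
                 g ∈ g₁ ∷ g₂ ∷ gs → length g < length w
factor-shorter {w} fs∈ g∈ with factorizations-sound w fs∈
... | refl , ne = proper-factor-shorter ne g∈

isNondecrFactorization : (Word → Bool) → List Word → Bool
isNondecrFactorization nyl fs = atLeastTwo fs ∧ (all nyl fs ∧ nondecr fs)

any-isNondecrFactorization-cong : ∀ w {p q : Word → Bool} → (∀ g → length g < length w → p g ≡ q g) →
  any (isNondecrFactorization p) (factorizations w) ≡ any (isNondecrFactorization q) (factorizations w)
any-isNondecrFactorization-cong w {p} {q} p≗q = cong or (map-cong-local (All.tabulate agree))
  where
  agree : ∀ {fs} → fs ∈ factorizations w → isNondecrFactorization p fs ≡ isNondecrFactorization q fs
  agree {[]}            _   = refl
  agree {_ ∷ []}        _   = refl
  agree {fs@(_ ∷ _ ∷ _)} fs∈ =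
    cong (λ b → true ∧ (b ∧ nondecr fs))
      (cong and (map-cong-local (All.tabulate (λ {g} g∈ → p≗q g (factor-shorter {w} fs∈ g∈)))))

nyldonF-fuel : ∀ f f' w → length w ≤ f → length w ≤ f' → nyldonF f w ≡ nyldonF f' w
nyldonF-fuel zero    zero     _           _ _ = refl
nyldonF-fuel zero    (suc _)  []          _ _ = refl
nyldonF-fuel (suc _) zero     []          _ _ = refl
nyldonF-fuel (suc _) (suc _)  []          _ _ = refl
nyldonF-fuel (suc _) (suc _)  (_ ∷ [])    _ _ = refl
nyldonF-fuel (suc f) (suc f') w@(_ ∷ _ ∷ _) w≤f w≤f' =
  cong not (any-isNondecrFactorization-cong w λ g g<w →
    nyldonF-fuel f f' g (≤-pred (≤-trans g<w w≤f)) (≤-pred (≤-trans g<w w≤f')))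

isNyldon-unfold : ∀ w → 2 ≤ length w →
  isNyldon w ≡ not (any (isNondecrFactorization isNyldon) (factorizations w))
isNyldon-unfold (_ ∷ []) (s≤s ())
isNyldon-unfold w@(_ ∷ _ ∷ _) _ = cong not (any-isNondecrFactorization-cong w λ g g<w →
  nyldonF-fuel _ _ g (≤-pred g<w) ≤-refl)

T-not⁻ : ∀ {b} → T (not b) → ¬ T b
T-not⁻ {false} _ ()

T-not⁺ : ∀ {b} → ¬ T b → T (not b)
T-not⁺ {false} _  = _
T-not⁺ {true}  ¬b = ¬b _

¬T-not : ∀ {b} → ¬ T (not b) → T b
¬T-not {false} ¬nb = ¬nb _
¬T-not {true}  _   = _

T-injective : ∀ {a b} → (T a → T b) → (T b → T a) → a ≡ b
T-injective {false} {false} _   _   = refl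
T-injective {false} {true}  _   b⇒a = ⊥-elim (b⇒a _)
T-injective {true}  {false} a⇒b _   = ⊥-elim (a⇒b _)
T-injective {true}  {true}  _   _   = refl

record NyldonFactorization (w : Word) : Set where
  field
    first second : Word
    rest         : List Word
    concat≡      : first ++ second ++ concat rest ≡ w
    nonEmpty-factors : All NonEmpty (first ∷ second ∷ rest)
    nyldon-factors   : All (T ∘ isNyldon) (first ∷ second ∷ rest)
    nondecreasing    : T (nondecr (first ∷ second ∷ rest))

  first≤second : T (lexLe first second)
  first≤second = proj₁ (Equivalence.to T-∧ nondecreasing)

  two≤length : 2 ≤ length w
  two≤length = subst (λ v → 2 ≤ length v) concat≡
    (≤-<-trans (nonEmpty-length (All.head nonEmpty-factors))
               (proper-factor-shorter nonEmpty-factors (here refl)))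

factorization⇒¬nyldon : ∀ {w} → NyldonFactorization w → ¬ T (isNyldon w)
factorization⇒¬nyldon {w} F ny =
  T-not⁻ (subst T (isNyldon-unfold w two≤length) ny)
    (Any.any⁺ _ (lose (factorizations-complete w _ concat≡ nonEmpty-factors)
                      (Equivalence.from (T-∧ {all isNyldon (first ∷ second ∷ rest)})
                        (All.all⁻ _ nyldon-factors , nondecreasing))))
  where open NyldonFactorization F

¬nyldon⇒factorization : ∀ w → 2 ≤ length w → ¬ T (isNyldon w) → NyldonFactorization w
¬nyldon⇒factorization w 2≤w ¬ny
  with find (Any.any⁻ (isNondecrFactorization isNyldon) (factorizations w)
                      (¬T-not (¬ny ∘ subst T (sym (isNyldon-unfold w 2≤w)))))
... | []          , _   , ()
... | _ ∷ []      , _   , ()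
... | g₁ ∷ g₂ ∷ gs , fs∈ , red
  with factorizations-sound w fs∈ | Equivalence.to (T-∧ {all isNyldon (g₁ ∷ g₂ ∷ gs)}) red
...   | concat≡ , ne | nyl , nd = record
  { first = g₁ ; second = g₂ ; rest = gs ; concat≡ = concat≡ ; nonEmpty-factors = ne
  ; nyldon-factors = All.all⁺ _ (g₁ ∷ g₂ ∷ gs) nyl ; nondecreasing = nd }

-- Lexicographic order and words that are not Nyldon

lexLt⇒lexLe : ∀ u v → T (lexLt u v) → T (lexLe u v)
lexLt⇒lexLe u v lt = Equivalence.from (T-∨ {lexLt u v}) (inj₁ lt)

lexLt-∷⁻ : ∀ a b x y → T (lexLt (a ∷ x) (b ∷ y)) → a < b ⊎ (a ≡ b × T (lexLt x y))
lexLt-∷⁻ a b x y lt with Equivalence.to (T-∨ {a <ᵇ b}) lt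
... | inj₁ a<b = inj₁ (<ᵇ⇒< a b a<b)
... | inj₂ a≡b×lt = let a≡b , lt′ = Equivalence.to (T-∧ {a ≡ᵇ b}) a≡b×lt in
  inj₂ (≡ᵇ⇒≡ a b a≡b , lt′)

lexLe-∷⁻ : ∀ a b x y → T (lexLe (a ∷ x) (b ∷ y)) → a < b ⊎ (a ≡ b × T (lexLe x y))
lexLe-∷⁻ a b x y le with Equivalence.to (T-∨ {lexLt (a ∷ x) (b ∷ y)}) le
... | inj₁ lt = Sum.map₂ (Product.map₂ (lexLt⇒lexLe x y)) (lexLt-∷⁻ a b x y lt)
... | inj₂ eq = let a≡b , eq′ = Equivalence.to (T-∧ {a ≡ᵇ b}) eq in
  inj₂ (≡ᵇ⇒≡ a b a≡b , Equivalence.from (T-∨ {lexLt x y}) (inj₂ eq′))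

lexLt-∷⁺ : ∀ a x y → T (lexLt x y) → T (lexLt (a ∷ x) (a ∷ y))
lexLt-∷⁺ a x y lt =
  Equivalence.from (T-∨ {a <ᵇ a}) (inj₂ (Equivalence.from (T-∧ {a ≡ᵇ a}) (≡⇒≡ᵇ a a refl , lt)))

lexLe-∷⁺ : ∀ a x y → T (lexLe x y) → T (lexLe (a ∷ x) (a ∷ y))
lexLe-∷⁺ a x y le with Equivalence.to (T-∨ {lexLt x y}) le
... | inj₁ lt = lexLt⇒lexLe (a ∷ x) (a ∷ y) (lexLt-∷⁺ a x y lt)
... | inj₂ eq = Equivalence.from (T-∨ {lexLt (a ∷ x) (a ∷ y)})
                  (inj₂ (Equivalence.from (T-∧ {a ≡ᵇ a}) (≡⇒≡ᵇ a a refl , eq)))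

lexLe-++ : ∀ x y → T (lexLe x (x ++ y))
lexLe-++ []      []      = _
lexLe-++ []      (_ ∷ _) = _
lexLe-++ (a ∷ x) y       = lexLe-∷⁺ a x (x ++ y) (lexLe-++ x y)

lexLt-++ : ∀ x c z → T (lexLt x (x ++ c ∷ z))
lexLt-++ []      c z = _
lexLt-++ (a ∷ x) c z = lexLt-∷⁺ a x (x ++ c ∷ z) (lexLt-++ x c z)

lexLt-irrefl : ∀ x → ¬ T (lexLt x x)
lexLt-irrefl (a ∷ x) lt with lexLt-∷⁻ a a x x lt
... | inj₁ a<a       = <-irrefl refl a<a
... | inj₂ (_ , lt′) = lexLt-irrefl x lt′

++-≰lexLe : ∀ x {y} → NonEmpty y → ¬ T (lexLe (x ++ y) x)
++-≰lexLe []      nonEmpty ()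
++-≰lexLe (a ∷ x) {y} ne le with lexLe-∷⁻ a a (x ++ y) x le
... | inj₁ a<a       = <-irrefl refl a<a
... | inj₂ (_ , le′) = ++-≰lexLe x ne le′

¬nyldon-++ : ∀ u v → NonEmpty u → NonEmpty v → T (isNyldon u) → T (isNyldon v) →
             T (lexLe u v) → ¬ T (isNyldon (u ++ v))
¬nyldon-++ u v neu nev nyu nyv u≤v = factorization⇒¬nyldon record
  { first = u ; second = v ; rest = [] ; concat≡ = cong (u ++_) (++-identityʳ v)
  ; nonEmpty-factors = neu ∷ nev ∷ [] ; nyldon-factors = nyu ∷ nyv ∷ []
  ; nondecreasing = Equivalence.from (T-∧ {lexLe u v}) (u≤v , _) }

¬nyldon-square-++ : ∀ u z → NonEmpty u → T (isNyldon u) → T (isNyldon (u ++ z)) →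
                    ¬ T (isNyldon (u ++ u ++ z))
¬nyldon-square-++ u@(_ ∷ _) z ne nyu nyuz = ¬nyldon-++ u (u ++ z) ne nonEmpty nyu nyuz (lexLe-++ u z)

factorization-∷ : ∀ {a y} → NyldonFactorization (a ∷ y) → NyldonFactorization (a ∷ a ∷ y)
factorization-∷ record { first = [] ; nonEmpty-factors = () ∷ _ }
factorization-∷ {a} record { first = _ ∷ s ; second = g₂ ; rest = gs ; concat≡ = refl
                           ; nonEmpty-factors = ne ; nyldon-factors = ny ; nondecreasing = nd } = record
  { first = [ a ] ; second = a ∷ s ; rest = g₂ ∷ gs ; concat≡ = refl
  ; nonEmpty-factors = nonEmpty ∷ ne ; nyldon-factors = _ ∷ ny
  ; nondecreasing = Equivalence.from (T-∧ {lexLe [ a ] (a ∷ s)}) (lexLe-++ [ a ] s , nd) }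

¬nyldon-aa : ∀ a y → ¬ T (isNyldon (a ∷ a ∷ y))
¬nyldon-aa a y with T? (isNyldon (a ∷ y))
... | yes ny  = ¬nyldon-++ [ a ] (a ∷ y) nonEmpty nonEmpty _ ny (lexLe-++ [ a ] y)
¬nyldon-aa a []      | no ¬ny = ⊥-elim (¬ny _)
¬nyldon-aa a y@(_ ∷ _) | no ¬ny =
  factorization⇒¬nyldon (factorization-∷ (¬nyldon⇒factorization (a ∷ y) (s≤s (s≤s z≤n)) ¬ny))

isPrefixOf : Word → Word → Bool
isPrefixOf []      _       = true
isPrefixOf (_ ∷ _) []      = false
isPrefixOf (a ∷ p) (b ∷ w) = (a ≡ᵇ b) ∧ isPrefixOf p w

isProperPrefixOf : Word → Word → Bool
isProperPrefixOf p w = (length p <ᵇ length w) ∧ isPrefixOf p w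

isPrefixOf-++ : ∀ p z → T (isPrefixOf p (p ++ z))
isPrefixOf-++ []      z = _
isPrefixOf-++ (a ∷ p) z = Equivalence.from (T-∧ {a ≡ᵇ a}) (≡⇒≡ᵇ a a refl , isPrefixOf-++ p z)

isPrefixOf⇒++ : ∀ p w → T (isPrefixOf p w) → ∃[ z ] w ≡ p ++ z
isPrefixOf⇒++ []      w       _    = w , refl
isPrefixOf⇒++ (a ∷ p) (b ∷ w) a∷p≤ with Equivalence.to (T-∧ {a ≡ᵇ b}) a∷p≤
... | a≡b , p≤ with ≡ᵇ⇒≡ a b a≡b | isPrefixOf⇒++ p w p≤
...   | refl | z , refl = z , refl

isProperPrefixOf-++ : ∀ p c z → T (isProperPrefixOf p (p ++ c ∷ z))
isProperPrefixOf-++ p c z = Equivalence.from (T-∧ {length p <ᵇ length (p ++ c ∷ z)})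
  (<⇒<ᵇ (subst (length p <_) (sym (length-++ p)) (m<m+n (length p) (s≤s z≤n))) , isPrefixOf-++ p (c ∷ z))

isProperPrefixOf⇒++ : ∀ p w → T (isProperPrefixOf p w) → ∃[ c ] ∃[ z ] w ≡ p ++ c ∷ z
isProperPrefixOf⇒++ p w pp with Equivalence.to (T-∧ {length p <ᵇ length w}) pp
... | p<w , p≤w with isPrefixOf⇒++ p w p≤w
...   | c ∷ z , w≡ = c , z , w≡
...   | [] , refl = ⊥-elim (<-irrefl (sym (cong length (++-identityʳ p))) (<ᵇ⇒< _ _ p<w))

isPrefixOf-long : ∀ p w → length w < length p → ¬ T (isPrefixOf p w)
isPrefixOf-long (a ∷ p) (b ∷ w) (s≤s w<p) a∷p≤ =
  isPrefixOf-long p w w<p (proj₂ (Equivalence.to (T-∧ {a ≡ᵇ b}) a∷p≤))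

length-replicate-++-≥ : ∀ j {a} (r : Word) → j ≤ length (replicate j a ++ r)
length-replicate-++-≥ zero    r = z≤n
length-replicate-++-≥ (suc j) r = s≤s (length-replicate-++-≥ j r)

length-replicate-++-∷-≥ : ∀ j {a b} (r : Word) → suc j ≤ length (replicate j a ++ b ∷ r)
length-replicate-++-∷-≥ zero    r = s≤s z≤n
length-replicate-++-∷-≥ (suc j) r = s≤s (length-replicate-++-∷-≥ j r)

length-suffix : ∀ (u : Word) {z b} → length (u ++ z) ≤ length u + b → length z ≤ b
length-suffix u h = +-cancelˡ-≤ (length u) _ _ (subst (_≤ _) (length-++ u) h)

-- Dips

Bounded : ℕ → Word → Set
Bounded m = All (_≤ m)

replicate-bounded : ∀ j {m} → Bounded m (replicate j m)
replicate-bounded zero    = []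
replicate-bounded (suc j) = ≤-refl ∷ replicate-bounded j

-- With m = suc k the largest letter, dip k j is m (m−1) mʲ, and the word u of the theorem is dip k (n ∸ 2).
dip : ℕ → ℕ → Word
dip k j = suc k ∷ k ∷ replicate j (suc k)

dip-bounded : ∀ k j → Bounded (suc k) (dip k j)
dip-bounded k j = ≤-refl ∷ n≤1+n k ∷ replicate-bounded j

replicate-++-∷ : ∀ j {a} (r : Word) → replicate j a ++ a ∷ r ≡ a ∷ replicate j a ++ r
replicate-++-∷ zero        r = refl
replicate-++-∷ (suc j) {a} r = cong (a ∷_) (replicate-++-∷ j r)

dip-square-++ : ∀ k p z → (dip k p ++ dip k p) ++ z ≡ dip k (suc p) ++ k ∷ replicate p (suc k) ++ z
dip-square-++ k p z =
  cong (λ v → suc k ∷ k ∷ v) (trans (++-assoc (replicate p (suc k)) (dip k p) z) (replicate-++-∷ p _))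

length-dip : ∀ k j → length (dip k j) ≡ 2 + j
length-dip k j = cong (suc ∘ suc) (length-replicate j)

max-head : ∀ {m c} s r → c ≤ m → T (lexLe (m ∷ s) (c ∷ r)) → c ≡ m × T (lexLe s r)
max-head {m} {c} s r c≤m le with lexLe-∷⁻ m c s r le
... | inj₁ m<c          = ⊥-elim (<⇒≱ m<c c≤m)
... | inj₂ (refl , le′) = refl , le′

lexLe-replicate : ∀ j {m s r} → Bounded m r → T (lexLe (replicate j m ++ s) r) →
                  ∃[ r′ ] r ≡ replicate j m ++ r′
lexLe-replicate zero    {r = r}     _          _  = r , refl
lexLe-replicate (suc j) {r = []}    _          ()
lexLe-replicate (suc j) {m} {s} {c ∷ r} (c≤m ∷ br) le with max-head (replicate j m ++ s) r c≤m le
... | refl , le′ = Product.map₂ (cong (m ∷_)) (lexLe-replicate j br le′)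

lexLe-dip : ∀ {k j s w} → Bounded (suc k) w → T (lexLe (dip k j ++ s) w) →
            (∃[ y ] w ≡ suc k ∷ suc k ∷ y) ⊎ (∃[ r ] w ≡ dip k j ++ r)
lexLe-dip {w = []}    _          ()
lexLe-dip {k} {j} {s} {_ ∷ []} (c≤ ∷ _) le with max-head (k ∷ replicate j (suc k) ++ s) [] c≤ le
... | refl , ()
lexLe-dip {k} {j} {s} {_ ∷ d ∷ w} (c≤ ∷ d≤ ∷ bw) le
  with max-head (k ∷ replicate j (suc k) ++ s) (d ∷ w) c≤ le
... | refl , le′ with lexLe-∷⁻ k d (replicate j (suc k) ++ s) w le′
...   | inj₁ k<d          = inj₁ (w , cong (λ e → suc k ∷ e ∷ w) (≤-antisym d≤ k<d))
...   | inj₂ (refl , le″) = inj₂ (Product.map₂ (cong (λ v → suc k ∷ k ∷ v)) (lexLe-replicate j bw le″))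

lexLe-dip-nyldon : ∀ {k j s w} → Bounded (suc k) w → T (isNyldon w) → T (lexLe (dip k j ++ s) w) →
                   ∃[ r ] w ≡ dip k j ++ r
lexLe-dip-nyldon bw ny le with lexLe-dip bw le
... | inj₁ (y , refl) = ⊥-elim (¬nyldon-aa _ y ny)
... | inj₂ w≡         = w≡

++-≡-replicate-++ : ∀ {c} q (a s x : Word) → a ++ s ≡ replicate q c ++ x →
    (∃[ i ] ∃[ j ] i + j ≡ q × a ≡ replicate i c × s ≡ replicate j c ++ x)
  ⊎ (∃[ x′ ] NonEmpty x′ × a ≡ replicate q c ++ x′ × x ≡ x′ ++ s)
++-≡-replicate-++ q       []          s x eq = inj₁ (0 , q , refl , refl , eq)
++-≡-replicate-++ zero    a@(_ ∷ _)   s x eq = inj₂ (a , nonEmpty , refl , sym eq)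
++-≡-replicate-++ (suc q) (_ ∷ a)     s x eq with ∷-injective eq
... | refl , eq′ with ++-≡-replicate-++ q a s x eq′
...   | inj₁ (i , j , i+j≡q , refl , s≡) = inj₁ (suc i , j , cong suc i+j≡q , refl , s≡)
...   | inj₂ (x′ , ne , refl , x≡)      = inj₂ (x′ , ne , refl , x≡)

-- By dip-square-++, the first two constructors say that dip k (suc p) ++ x begins with the
-- square of dip k p or of dip k (suc p).
data Obstruction (k p : ℕ) : Word → Set where
  shorter-square : ∀ y → Obstruction k p (k ∷ replicate p (suc k) ++ y)
  square         : ∀ y → Obstruction k p (dip k (suc p) ++ y)
  long           : ∀ {x} → 5 + p ≤ length x → Obstruction k p x

obstruction-length : ∀ {k p x} → Obstruction k p x → p < length x
obstruction-length {p = p} (shorter-square y) = s≤s (length-replicate-++-≥ p y)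
obstruction-length {p = p} (square y)         = s≤s (≤-trans (length-replicate-++-≥ p y) (m≤n+m _ 2))
obstruction-length {p = p} (long 5+p≤x)       = ≤-trans (s≤s (m≤n+m p 4)) 5+p≤x

second-dip⇒obstruction : ∀ {k p x} i j r s → i + j ≡ suc p →
                          (dip k i ++ r) ++ s ≡ replicate j (suc k) ++ x → Obstruction k p x
second-dip⇒obstruction {k} {p} i zero r s i+0≡ refl with trans (sym (+-identityʳ i)) i+0≡
... | refl = subst (Obstruction k p) (sym (++-assoc (dip k (suc p)) r s)) (square (r ++ s))
second-dip⇒obstruction {k} {p} i (suc zero) r s i+1≡ refl with suc-injective (trans (+-comm 1 i) i+1≡)
... | refl = subst (Obstruction k p) (cong (k ∷_) (sym (++-assoc (replicate p (suc k)) r s)))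
               (shorter-square (r ++ s))
second-dip⇒obstruction i (suc (suc j)) r s _ eq = ⊥-elim (1+n≢n (sym (∷-injectiveˡ (∷-injectiveʳ eq))))

-- The second factor is Nyldon, so it cannot start with m m; being ≥ the first factor m (m−1) ⋯,
-- it therefore repeats the first factor's dip, and where it starts decides the obstruction.
dip-factorization⇒obstruction : ∀ {k p x w₁ w₂ s} → NonEmpty w₁ → Bounded (suc k) w₂ →
  T (isNyldon w₂) → T (lexLe w₁ w₂) → w₁ ++ w₂ ++ s ≡ dip k (suc p) ++ x → Obstruction k p x
dip-factorization⇒obstruction {w₁ = _ ∷ []} {[]} _ _ _ () _
dip-factorization⇒obstruction {k} {w₁ = _ ∷ []} {_ ∷ w₂} _ _ _ le eq with ∷-injective eq
... | refl , eq′ with ∷-injective eq′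
...   | refl , _ with lexLe-∷⁻ (suc k) k [] w₂ le
...     | inj₁ 1+k<k       = ⊥-elim (<-asym 1+k<k (n<1+n k))
...     | inj₂ (1+k≡k , _) = ⊥-elim (1+n≢n 1+k≡k)
dip-factorization⇒obstruction {k} {p} {x} {_ ∷ _ ∷ v} {w₂} {s} _ bw₂ ny₂ le eq with ∷-injective eq
... | refl , eq′ with ∷-injective eq′
...   | refl , eq″ with ++-≡-replicate-++ (suc p) v (w₂ ++ s) x eq″
...     | inj₁ (i , j , i+j≡ , refl , w₂s≡)
  with lexLe-dip-nyldon {j = i} {s = []} bw₂ ny₂ (subst (T ∘ flip lexLe w₂) (sym (++-identityʳ (dip k i))) le)
...       | r , refl = second-dip⇒obstruction i j r s i+j≡ w₂s≡
dip-factorization⇒obstruction {k} {p} {x} {_ ∷ _ ∷ v} {w₂} {s} _ bw₂ ny₂ le eq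
        | refl , eq′ | refl , eq″ | inj₂ (x′ , ne , refl , refl) with lexLe-dip-nyldon {s = x′} bw₂ ny₂ le
...       | [] , refl    = ⊥-elim (++-≰lexLe (dip k (suc p)) ne
                             (subst (T ∘ lexLe (dip k (suc p) ++ x′)) (++-identityʳ (dip k (suc p))) le))
...       | c ∷ r , refl = long (subst (5 + p ≤_) (sym (length-++ x′))
                (+-mono-≤ (nonEmpty-length ne)
                  (≤-trans (s≤s (s≤s (length-replicate-++-∷-≥ (suc p) r)))
                           (length-++-≤ˡ (dip k (suc p) ++ c ∷ r)))))

dip-++-obstruction : ∀ {k} p {x} → Bounded (suc k) x → ¬ T (isNyldon (dip k (suc p) ++ x)) → Obstruction k p x
dip-++-obstruction {k} p {x} bx ¬ny =
  dip-factorization⇒obstruction (All.head nonEmpty-factors) bounded-second (All.head (All.tail nyldon-factors))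
                first≤second concat≡
  where
  open NyldonFactorization (¬nyldon⇒factorization (dip k (suc p) ++ x) (s≤s (s≤s z≤n)) ¬ny)
  bounded-second : Bounded (suc k) second
  bounded-second = All.++⁻ˡ second (All.++⁻ʳ first
    (subst (Bounded (suc k)) (sym concat≡) (All.++⁺ (dip-bounded k (suc p)) bx)))

nyldon-dip-++ : ∀ {k} p {x} → Bounded (suc k) x → length x ≤ p → T (isNyldon (dip k (suc p) ++ x))
nyldon-dip-++ p bx x≤p = decidable-stable (T? _) λ ¬ny →
  <⇒≱ (obstruction-length (dip-++-obstruction p bx ¬ny)) x≤p

nyldon-dip : ∀ k p → T (isNyldon (dip k (suc p)))
nyldon-dip k p = subst (T ∘ isNyldon) (++-identityʳ (dip k (suc p))) (nyldon-dip-++ p [] z≤n)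

¬nyldon-dip-square-prefix : ∀ {k} p {w} → Bounded (suc k) w →
  length w ≤ length (dip k (suc p) ++ dip k (suc p)) + p →
  T (isPrefixOf (dip k (suc p) ++ dip k (suc p)) w) → ¬ T (isNyldon w)
¬nyldon-dip-square-prefix {k} p {w} bw w≤ D²≤w with isPrefixOf⇒++ (dip k (suc p) ++ dip k (suc p)) w D²≤w
... | z , refl = subst (¬_ ∘ T ∘ isNyldon) (sym (++-assoc D D z))
  (¬nyldon-square-++ D z nonEmpty (nyldon-dip k p)
    (nyldon-dip-++ p (All.++⁻ʳ (D ++ D) bw) (length-suffix (D ++ D) w≤)))
  where
  D : Word
  D = dip k (suc p)

-- Sums and counting

∑ : ℕ → (ℕ → ℕ) → ℕ
∑ zero    f = 0
∑ (suc n) f = f 0 + ∑ n (f ∘ suc)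

infix 5 ∑
syntax ∑ n (λ i → e) = ∑[ i < n ] e

∑-cong : ∀ n {f g} → (∀ {i} → i < n → f i ≡ g i) → ∑ n f ≡ ∑ n g
∑-cong zero    _   = refl
∑-cong (suc n) f≗g = cong₂ _+_ (f≗g (s≤s z≤n)) (∑-cong n (f≗g ∘ s≤s))

∑-zero : ∀ n {f} → (∀ {i} → i < n → f i ≡ 0) → ∑ n f ≡ 0
∑-zero zero    _   = refl
∑-zero (suc n) f≗0 = cong₂ _+_ (f≗0 (s≤s z≤n)) (∑-zero n (f≗0 ∘ s≤s))

∑-+ : ∀ m n f → ∑ (m + n) f ≡ ∑ m f + (∑[ i < n ] f (m + i))
∑-+ zero    n f = refl
∑-+ (suc m) n f = trans (cong (f 0 +_) (∑-+ m n (f ∘ suc))) (sym (+-assoc (f 0) _ _))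

∑-const : ∀ n c → ∑[ i < n ] c ≡ n * c
∑-const zero    c = refl
∑-const (suc n) c = cong (c +_) (∑-const n c)

∑-single : ∀ n {b f} → b < n → (∀ {i} → i ≢ b → f i ≡ 0) → ∑ n f ≡ f b
∑-single (suc n) {zero}  {f} _ f≗0 =
  trans (cong (f 0 +_) (∑-zero n (λ _ → f≗0 (λ ())))) (+-identityʳ (f 0))
∑-single (suc n) {suc b} {f} (s≤s b<n) f≗0 =
  trans (cong (_+ ∑ n (f ∘ suc)) (f≗0 (λ ()))) (∑-single n b<n (λ i≢b → f≗0 (i≢b ∘ suc-injective)))

∑-*ˡ : ∀ n c f → ∑[ i < n ] (c * f i) ≡ c * ∑ n f
∑-*ˡ zero    c f = sym (*-zeroʳ c)
∑-*ˡ (suc n) c f = trans (cong (c * f 0 +_) (∑-*ˡ n c (f ∘ suc))) (sym (*-distribˡ-+ c (f 0) _))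

∑-geometric : ∀ m r → (∑[ i < r ] suc m ^ i) * m + 1 ≡ suc m ^ r
∑-geometric m zero    = refl
∑-geometric m (suc r) = begin
  (1 + (∑[ i < r ] suc m * suc m ^ i)) * m + 1 ≡⟨ cong (λ s → (1 + s) * m + 1) (∑-*ˡ r (suc m) (suc m ^_)) ⟩
  (1 + suc m * S) * m + 1                        ≡⟨ expand m S ⟩
  suc m * (S * m + 1)                            ≡⟨ cong (suc m *_) (∑-geometric m r) ⟩
  suc m * suc m ^ r                              ∎
  where
  open ≡-Reasoning
  S : ℕ
  S = ∑[ i < r ] suc m ^ i
  expand : ∀ m S → (1 + suc m * S) * m + 1 ≡ suc m * (S * m + 1)
  expand = solve-∀

∑-geometric-/ : ∀ m r .{{_ : NonZero m}} → (suc m ^ suc r ∸ suc m) / m ≡ ∑[ i < r ] suc m ^ suc i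
∑-geometric-/ m r = begin
  (suc m ^ suc r ∸ suc m) / m        ≡⟨ cong (λ e → (e ∸ suc m) / m) shifted ⟩
  (P * m + suc m ∸ suc m) / m        ≡⟨ cong (_/ m) (m+n∸n≡m (P * m) (suc m)) ⟩
  P * m / m                          ≡⟨ m*n/n≡m P m ⟩
  P                                  ∎
  where
  open ≡-Reasoning
  P S : ℕ
  P = ∑[ i < r ] suc m ^ suc i
  S = ∑[ i < r ] suc m ^ i
  shifted : suc m ^ suc r ≡ P * m + suc m
  shifted = begin
    suc m * suc m ^ r                         ≡⟨ cong (suc m *_) (sym (∑-geometric m r)) ⟩
    suc m * (S * m + 1)                       ≡⟨ *-distribˡ-+ (suc m) (S * m) 1 ⟩
    suc m * (S * m) + suc m * 1               ≡⟨ cong₂ _+_ (sym (*-assoc (suc m) S m)) (*-identityʳ (suc m)) ⟩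
    suc m * S * m + suc m                     ≡⟨ cong (λ s → s * m + suc m) (sym (∑-*ˡ r (suc m) (suc m ^_))) ⟩
    P * m + suc m                             ∎

count : {A : Set} → (A → Bool) → List A → ℕ
count p xs = length (filter (λ x → T? (p x)) xs)

count-++ : ∀ {A : Set} (p : A → Bool) xs ys → count p (xs ++ ys) ≡ count p xs + count p ys
count-++ p xs ys = trans (cong length (filter-++ (T? ∘ p) xs ys)) (length-++ (filter (T? ∘ p) xs))

count-map : ∀ {A B : Set} (p : B → Bool) (f : A → B) xs → count p (map f xs) ≡ count (p ∘ f) xs
count-map p f []       = refl
count-map p f (x ∷ xs) with p (f x)
... | true  = cong suc (count-map p f xs)
... | false = count-map p f xs

count-cong : ∀ {A : Set} {p q : A → Bool} {xs} → All (λ x → p x ≡ q x) xs → count p xs ≡ count q xs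
count-cong {p = p} {q} {x ∷ xs} (px≡qx ∷ eqs) with p x | q x
... | true  | true  = cong suc (count-cong eqs)
... | false | false = count-cong eqs
count-cong [] = refl

count-∧-true : ∀ {A : Set} {c} (q : A → Bool) xs → T c → count (λ x → c ∧ q x) xs ≡ count q xs
count-∧-true {c = true} q xs _ = refl

count-∧-false : ∀ {A : Set} {c} (q : A → Bool) xs → ¬ T c → count (λ x → c ∧ q x) xs ≡ 0
count-∧-false {c = true}  q xs ¬c = ⊥-elim (¬c _)
count-∧-false {c = false} q []       _ = refl
count-∧-false {c = false} q (_ ∷ xs) ¬c = count-∧-false q xs ¬c

count-none : ∀ {A : Set} (p : A → Bool) {xs} → All (λ x → ¬ T (p x)) xs → count p xs ≡ 0
count-none p []                = refl
count-none p {x ∷ _} (¬px ∷ ¬ps) with p x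
... | true  = ⊥-elim (¬px _)
... | false = count-none p ¬ps

count-concatMap-applyUpTo : ∀ {A B : Set} (p : B → Bool) (f : A → List B) g n →
                            count p (concatMap f (applyUpTo g n)) ≡ ∑[ i < n ] count p (f (g i))
count-concatMap-applyUpTo p f g zero    = refl
count-concatMap-applyUpTo p f g (suc n) =
  trans (count-++ p (f (g 0)) _) (cong (count p (f (g 0)) +_) (count-concatMap-applyUpTo p f (g ∘ suc) n))

count-partition : ∀ {A : Set} (a b c : A → Bool) xs →
  (∀ x → T (b x) → T (a x)) → (∀ x → T (c x) → T (a x)) → (∀ x → T (b x) → ¬ T (c x)) →
  count (λ x → a x ∧ (not (b x) ∧ not (c x))) xs + (count b xs + count c xs) ≡ count a xs
count-partition {A} a b c xs b⇒a c⇒a b⇒¬c = go xs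
  where
  rest : List A → ℕ
  rest = count (λ x → a x ∧ (not (b x) ∧ not (c x)))
  go : ∀ xs → rest xs + (count b xs + count c xs) ≡ count a xs
  go []       = refl
  go (x ∷ xs) with a x | b x | c x | b⇒a x | c⇒a x | b⇒¬c x | go xs
  ... | true  | false | false | _   | _   | _   | ih = cong suc ih
  ... | true  | true  | false | _   | _   | _   | ih = trans (+-suc (rest xs) _) (cong suc ih)
  ... | true  | false | true  | _   | _   | _   | ih =
    trans (cong (rest xs +_) (+-suc (count b xs) _)) (trans (+-suc (rest xs) _) (cong suc ih))
  ... | true  | true  | true  | _   | _   | ¬c  | _  = ⊥-elim (¬c _ _)
  ... | false | false | false | _   | _   | _   | ih = ih
  ... | false | true  | _     | b⇒a′ | _  | _   | _  = ⊥-elim (b⇒a′ _)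
  ... | false | false | true  | _   | c⇒a′ | _  | _  = ⊥-elim (c⇒a′ _)

wordsOfLength-spec : ∀ N L → All (λ w → length w ≡ L × All (_< N) w) (wordsOfLength N L)
wordsOfLength-spec N zero    = (refl , []) ∷ []
wordsOfLength-spec N (suc L) = All.concat⁺ (All.map⁺ (All.applyUpTo⁺₁ id N λ a<N →
  All.map⁺ (All.map (Product.map (cong suc) (a<N ∷_)) (wordsOfLength-spec N L))))

wordsUpTo-spec : ∀ N ℓ → All (λ w → length w ≤ ℓ × All (_< N) w) (wordsUpTo N ℓ)
wordsUpTo-spec N ℓ = All.concat⁺ (All.map⁺ {f = wordsOfLength N} (All.applyUpTo⁺₁ id (suc ℓ) λ L<1+ℓ →
  All.map (λ (w≡L , bw) → subst (_≤ ℓ) (sym w≡L) (≤-pred L<1+ℓ) , bw) (wordsOfLength-spec N _)))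

count-wordsOfLength : ∀ N L → count (λ _ → true) (wordsOfLength N L) ≡ N ^ L
count-wordsOfLength N zero    = refl
count-wordsOfLength N (suc L) = begin
  count (λ _ → true) (wordsOfLength N (suc L))
    ≡⟨ count-concatMap-applyUpTo (λ _ → true) (λ a → map (a ∷_) (wordsOfLength N L)) id N ⟩
  ∑[ a < N ] count (λ _ → true) (map (a ∷_) (wordsOfLength N L))
    ≡⟨ ∑-cong N (λ {a} _ → trans (count-map (λ (_ : Word) → true) (a ∷_) (wordsOfLength N L))
                                 (count-wordsOfLength N L)) ⟩
  ∑[ a < N ] N ^ L                                     ≡⟨ ∑-const N (N ^ L) ⟩
  N * N ^ L                                            ∎
  where open ≡-Reasoning

count-isPrefixOf : ∀ {N} p L → All (_< N) p → count (isPrefixOf p) (wordsOfLength N (length p + L)) ≡ N ^ L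
count-isPrefixOf {N} []      L _          = count-wordsOfLength N L
count-isPrefixOf {N} (b ∷ p) L (b<N ∷ p<N) = begin
  count (isPrefixOf (b ∷ p)) (wordsOfLength N (suc (length p + L)))
    ≡⟨ count-concatMap-applyUpTo (isPrefixOf (b ∷ p)) (λ a → map (a ∷_) W) id N ⟩
  ∑[ a < N ] count (isPrefixOf (b ∷ p)) (map (a ∷_) W)
    ≡⟨ ∑-cong N (λ {a} _ → count-map (isPrefixOf (b ∷ p)) (a ∷_) W) ⟩
  ∑[ a < N ] count (λ w → (b ≡ᵇ a) ∧ isPrefixOf p w) W               ≡⟨ ∑-single N b<N off-b ⟩
  count (λ w → (b ≡ᵇ b) ∧ isPrefixOf p w) W
    ≡⟨ count-∧-true (isPrefixOf p) W (≡⇒≡ᵇ b b refl) ⟩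
  count (isPrefixOf p) W                                             ≡⟨ count-isPrefixOf p L p<N ⟩
  N ^ L                                                              ∎
  where
  open ≡-Reasoning
  W : List Word
  W = wordsOfLength N (length p + L)
  off-b : ∀ {a} → a ≢ b → count (λ w → (b ≡ᵇ a) ∧ isPrefixOf p w) W ≡ 0
  off-b {a} a≢b = count-∧-false {c = b ≡ᵇ a} (isPrefixOf p) W (a≢b ∘ sym ∘ ≡ᵇ⇒≡ _ _)

count-wordsUpTo : ∀ p N ℓ → count p (wordsUpTo N ℓ) ≡ ∑[ L < suc ℓ ] count p (wordsOfLength N L)
count-wordsUpTo p N ℓ = count-concatMap-applyUpTo p (wordsOfLength N) id (suc ℓ)

count-isPrefixOf-wordsUpTo : ∀ {N} p r → All (_< N) p →
                             count (isPrefixOf p) (wordsUpTo N (length p + r)) ≡ ∑[ i < suc r ] N ^ i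
count-isPrefixOf-wordsUpTo {N} p r p<N = begin
  count (isPrefixOf p) (wordsUpTo N (length p + r))   ≡⟨ count-wordsUpTo (isPrefixOf p) N (length p + r) ⟩
  ∑ (suc (length p + r)) C                             ≡⟨ cong (λ n → ∑ n C) (sym (+-suc (length p) r)) ⟩
  ∑ (length p + suc r) C                               ≡⟨ ∑-+ (length p) (suc r) C ⟩
  ∑ (length p) C + (∑[ i < suc r ] C (length p + i))
    ≡⟨ cong₂ _+_ (∑-zero (length p) too-short) (∑-cong (suc r) (λ {i} _ → count-isPrefixOf p i p<N)) ⟩
  ∑[ i < suc r ] N ^ i                                 ∎
  where
  open ≡-Reasoning
  C : ℕ → ℕ
  C L = count (isPrefixOf p) (wordsOfLength N L)
  too-short : ∀ {L} → L < length p → C L ≡ 0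
  too-short L<p = count-none (isPrefixOf p)
    (All.map (λ (w≡L , _) → isPrefixOf-long p _ (subst (_< length p) (sym w≡L) L<p)) (wordsOfLength-spec N _))

count-isProperPrefixOf-wordsUpTo : ∀ {N} p r → All (_< N) p →
  count (isProperPrefixOf p) (wordsUpTo N (length p + r)) ≡ ∑[ i < r ] N ^ suc i
count-isProperPrefixOf-wordsUpTo {N} p r p<N = begin
  count (isProperPrefixOf p) (wordsUpTo N (length p + r))
    ≡⟨ count-wordsUpTo (isProperPrefixOf p) N (length p + r) ⟩
  ∑ (suc (length p) + r) C                              ≡⟨ ∑-+ (suc (length p)) r C ⟩
  ∑ (suc (length p)) C + (∑[ i < r ] C (suc (length p) + i))
    ≡⟨ cong₂ _+_ (∑-zero (suc (length p)) not-longer) (∑-cong r (λ {i} _ → longer i)) ⟩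
  ∑[ i < r ] N ^ suc i                                  ∎
  where
  open ≡-Reasoning
  C : ℕ → ℕ
  C L = count (isProperPrefixOf p) (wordsOfLength N L)
  not-longer : ∀ {L} → L < suc (length p) → C L ≡ 0
  not-longer L≤p = count-none (isProperPrefixOf p) (All.map (λ (w≡L , _) pp →
    <⇒≱ (<ᵇ⇒< _ _ (proj₁ (Equivalence.to T-∧ pp))) (subst (_≤ length p) (sym w≡L) (≤-pred L≤p)))
    (wordsOfLength-spec N _))
  longer : ∀ i → C (suc (length p) + i) ≡ N ^ suc i
  longer i = begin
    C (suc (length p) + i)                                         ≡⟨ cong C (sym (+-suc (length p) i)) ⟩
    count (isProperPrefixOf p) (wordsOfLength N (length p + suc i))
      ≡⟨ count-cong (All.map (λ {w} (w≡L , _) → cong (_∧ isPrefixOf p w) (Equivalence.to T-≡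
           (<⇒<ᵇ (subst (length p <_) (sym w≡L) (m<m+n (length p) (s≤s z≤n))))))
         (wordsOfLength-spec N _)) ⟩
    count (isPrefixOf p) (wordsOfLength N (length p + suc i))      ≡⟨ count-isPrefixOf p (suc i) p<N ⟩
    N ^ suc i                                                      ∎

-- Nyldon words above u

-- With n = 7 + n₀, U is the word u of the theorem and V = dip k (n ∸ 3) is one letter shorter.
module AboveDip (k n₀ : ℕ) where

  N n ℓ : ℕ
  N = suc (suc k)
  n = 7 + n₀
  ℓ = 2 * n + 1

  U V : Word
  U = dip k (5 + n₀)
  V = dip k (4 + n₀)

  Q : Word → Bool
  Q w = isProperPrefixOf U w ∧ (not (isPrefixOf (V ++ V) w) ∧ not (isPrefixOf (U ++ U) w))

  ℓ≡U+ : ℓ ≡ length U + suc n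
  ℓ≡U+ = trans (arith n₀) (cong (_+ suc n) (sym (length-dip k (5 + n₀))))
    where
    arith : ∀ n₀ → 2 * (7 + n₀) + 1 ≡ 2 + (5 + n₀) + suc (7 + n₀)
    arith = solve-∀

  length-square : ∀ j → length (dip k j ++ dip k j) ≡ (2 + j) + (2 + j)
  length-square j = trans (length-++ (dip k j)) (cong₂ _+_ (length-dip k j) (length-dip k j))

  ℓ≡VV+ : ℓ ≡ length (V ++ V) + 3
  ℓ≡VV+ = trans (arith n₀) (cong (_+ 3) (sym (length-square (4 + n₀))))
    where
    arith : ∀ n₀ → 2 * (7 + n₀) + 1 ≡ (2 + (4 + n₀)) + (2 + (4 + n₀)) + 3
    arith = solve-∀

  ℓ≡UU+ : ℓ ≡ length (U ++ U) + 1
  ℓ≡UU+ = trans (arith n₀) (cong (_+ 1) (sym (length-square (5 + n₀))))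
    where
    arith : ∀ n₀ → 2 * (7 + n₀) + 1 ≡ (2 + (5 + n₀)) + (2 + (5 + n₀)) + 1
    arith = solve-∀

  VV-prefix⇒U-proper : ∀ w → T (isPrefixOf (V ++ V) w) → T (isProperPrefixOf U w)
  VV-prefix⇒U-proper w VV≤w with isPrefixOf⇒++ (V ++ V) w VV≤w
  ... | z , refl = subst (T ∘ isProperPrefixOf U) (sym (dip-square-++ k (4 + n₀) z)) (isProperPrefixOf-++ U k _)

  UU-prefix⇒U-proper : ∀ w → T (isPrefixOf (U ++ U) w) → T (isProperPrefixOf U w)
  UU-prefix⇒U-proper w UU≤w with isPrefixOf⇒++ (U ++ U) w UU≤w
  ... | z , refl = subst (T ∘ isProperPrefixOf U) (sym (++-assoc U U z)) (isProperPrefixOf-++ U (suc k) _)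

  VV-prefix⇒¬UU-prefix : ∀ w → T (isPrefixOf (V ++ V) w) → ¬ T (isPrefixOf (U ++ U) w)
  VV-prefix⇒¬UU-prefix w VV≤w UU≤w with isPrefixOf⇒++ (V ++ V) w VV≤w | isPrefixOf⇒++ (U ++ U) w UU≤w
  ... | z₁ , w≡VV++z₁ | z₂ , w≡UU++z₂ = 1+n≢n (sym (∷-injectiveˡ (++-cancelˡ U _ _ (begin
    U ++ k ∷ replicate (4 + n₀) (suc k) ++ z₁ ≡⟨ sym (dip-square-++ k (4 + n₀) z₁) ⟩
    (V ++ V) ++ z₁                            ≡⟨ trans (sym w≡VV++z₁) w≡UU++z₂ ⟩
    (U ++ U) ++ z₂                            ≡⟨ ++-assoc U U z₂ ⟩
    U ++ U ++ z₂                              ∎))))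
    where open ≡-Reasoning

  nyldon-above-U⇒Q : ∀ {w} → Bounded (suc k) w → length w ≤ ℓ → T (isNyldon w) → T (lexLt U w) → T (Q w)
  nyldon-above-U⇒Q {w} bw w≤ℓ ny U<w
    with lexLe-dip-nyldon {j = 5 + n₀} {s = []} bw ny
           (subst (λ u → T (lexLe u w)) (sym (++-identityʳ U)) (lexLt⇒lexLe U w U<w))
  ... | [] , refl = ⊥-elim (lexLt-irrefl U (subst (T ∘ lexLt U) (++-identityʳ U) U<w))
  ... | c ∷ x , refl = Equivalence.from (T-∧ {isProperPrefixOf U w′}) (isProperPrefixOf-++ U c x ,
      Equivalence.from (T-∧ {not (isPrefixOf (V ++ V) w′)}) (T-not⁺ ¬VV≤w , T-not⁺ ¬UU≤w))
    where
    w′ : Word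
    w′ = U ++ c ∷ x
    ¬VV≤w : ¬ T (isPrefixOf (V ++ V) w′)
    ¬VV≤w VV≤w = ¬nyldon-dip-square-prefix (3 + n₀) bw
      (≤-trans (subst (length w′ ≤_) ℓ≡VV+ w≤ℓ) (+-monoʳ-≤ (length (V ++ V)) (m≤m+n 3 n₀))) VV≤w ny
    ¬UU≤w : ¬ T (isPrefixOf (U ++ U) w′)
    ¬UU≤w UU≤w = ¬nyldon-dip-square-prefix (4 + n₀) bw
      (≤-trans (subst (length w′ ≤_) ℓ≡UU+ w≤ℓ) (+-monoʳ-≤ (length (U ++ U)) (m≤m+n 1 (3 + n₀)))) UU≤w ny

  no-obstruction : ∀ {x} → ¬ T (isPrefixOf (V ++ V) (U ++ x)) → ¬ T (isPrefixOf (U ++ U) (U ++ x)) →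
                   length x ≤ suc n → ¬ Obstruction k (4 + n₀) x
  no-obstruction ¬VV≤w _ _ (shorter-square y) =
    ¬VV≤w (subst (T ∘ isPrefixOf (V ++ V)) (dip-square-++ k (4 + n₀) y) (isPrefixOf-++ (V ++ V) y))
  no-obstruction _ ¬UU≤w _ (square y) =
    ¬UU≤w (subst (T ∘ isPrefixOf (U ++ U)) (++-assoc U U y) (isPrefixOf-++ (U ++ U) y))
  no-obstruction _ _ x≤1+n (long 9+n₀≤x) = <-irrefl refl (≤-trans 9+n₀≤x x≤1+n)

  Q⇒nyldon-above-U : ∀ {w} → Bounded (suc k) w → length w ≤ ℓ → T (Q w) → T (isNyldon w) × T (lexLt U w)
  Q⇒nyldon-above-U {w} bw w≤ℓ q with Equivalence.to (T-∧ {isProperPrefixOf U w}) q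
  ... | U⊏w , not-squares with Equivalence.to (T-∧ {not (isPrefixOf (V ++ V) w)}) not-squares
                             | isProperPrefixOf⇒++ U w U⊏w
  ...   | ¬VV≤w , ¬UU≤w | c , x , refl =
    decidable-stable (T? _) (λ ¬ny → no-obstruction
      (T-not⁻ {isPrefixOf (V ++ V) (U ++ c ∷ x)} ¬VV≤w) (T-not⁻ {isPrefixOf (U ++ U) (U ++ c ∷ x)} ¬UU≤w)
      (length-suffix U (subst (length (U ++ c ∷ x) ≤_) ℓ≡U+ w≤ℓ)) (dip-++-obstruction (4 + n₀) (All.++⁻ʳ U bw) ¬ny))
    , lexLt-++ U c x

  nyldon-above-U≡Q : ∀ {w} → Bounded (suc k) w → length w ≤ ℓ → (isNyldon w ∧ lexLt U w) ≡ Q w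
  nyldon-above-U≡Q bw w≤ℓ = T-injective
    (λ h → let ny , U<w = Equivalence.to T-∧ h in nyldon-above-U⇒Q bw w≤ℓ ny U<w)
    (Equivalence.from T-∧ ∘ Q⇒nyldon-above-U bw w≤ℓ)

  count-nyldon-above-U : countNyldonAbove (suc k) ℓ U ≡ (∑[ i < suc n ] N ^ suc i) ∸ (N ^ 3 + N ^ 2 + 2 * N + 2)
  count-nyldon-above-U = begin
    count (λ w → isNyldon w ∧ lexLt U w) W
      ≡⟨ count-cong (All.map (λ (w≤ℓ , w<N) → nyldon-above-U≡Q (All.map ≤-pred w<N) w≤ℓ)
                             (wordsUpTo-spec N ℓ)) ⟩
    count Q W                                     ≡⟨ sym (m+n∸n≡m (count Q W) E) ⟩
    count Q W + E ∸ E
      ≡⟨ cong (_∸ E) (count-partition (isProperPrefixOf U) (isPrefixOf (V ++ V)) (isPrefixOf (U ++ U)) W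
                        VV-prefix⇒U-proper UU-prefix⇒U-proper VV-prefix⇒¬UU-prefix) ⟩
    count (isProperPrefixOf U) W ∸ E               ≡⟨ cong₂ _∸_ count-U-proper count-squares ⟩
    (∑[ i < suc n ] N ^ suc i) ∸ (N ^ 3 + N ^ 2 + 2 * N + 2) ∎
    where
    open ≡-Reasoning
    W : List Word
    W = wordsUpTo N ℓ
    E : ℕ
    E = count (isPrefixOf (V ++ V)) W + count (isPrefixOf (U ++ U)) W
    dip<N : ∀ j → All (_< N) (dip k j)
    dip<N j = All.map s≤s (dip-bounded k j)
    count-U-proper : count (isProperPrefixOf U) W ≡ ∑[ i < suc n ] N ^ suc i
    count-U-proper = trans (cong (count (isProperPrefixOf U) ∘ wordsUpTo N) ℓ≡U+)
                           (count-isProperPrefixOf-wordsUpTo U (suc n) (dip<N (5 + n₀)))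
    sums : ∀ N → (∑[ i < 4 ] N ^ i) + (∑[ i < 2 ] N ^ i) ≡ N ^ 3 + N ^ 2 + 2 * N + 2
    sums N = normalised N
      where
      normalised : ∀ N → (1 + (N * 1 + (N * (N * 1) + (N * (N * (N * 1)) + 0)))) + (1 + (N * 1 + 0))
                         ≡ N * (N * (N * 1)) + N * (N * 1) + 2 * N + 2
      normalised = solve-∀
    count-squares : E ≡ N ^ 3 + N ^ 2 + 2 * N + 2
    count-squares = trans
      (cong₂ _+_
        (trans (cong (count (isPrefixOf (V ++ V)) ∘ wordsUpTo N) ℓ≡VV+)
               (count-isPrefixOf-wordsUpTo (V ++ V) 3 (All.++⁺ (dip<N (4 + n₀)) (dip<N (4 + n₀)))))
        (trans (cong (count (isPrefixOf (U ++ U)) ∘ wordsUpTo N) ℓ≡UU+)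
               (count-isPrefixOf-wordsUpTo (U ++ U) 1 (All.++⁺ (dip<N (5 + n₀)) (dip<N (5 + n₀))))))
      (sums N)

proposition6p6 : (m n : ℕ) → (m≥1 : 1 ≤ m) → 7 ≤ n →
    countNyldonAbove m (2 * n + 1) (m ∷ (m ∸ 1) ∷ replicate (n ∸ 2) m)
      ≡ ((suc m ^ (n + 2) ∸ suc m) / (suc m ∸ 1)) {{>-nonZero m≥1}}
        ∸ (suc m ^ 3 + suc m ^ 2 + 2 * suc m + 2)
proposition6p6 (suc k) (suc (suc (suc (suc (suc (suc (suc n₀))))))) _
               (s≤s (s≤s (s≤s (s≤s (s≤s (s≤s (s≤s z≤n))))))) = begin
  countNyldonAbove (suc k) ℓ U                   ≡⟨ count-nyldon-above-U ⟩
  (∑[ i < suc n ] N ^ suc i) ∸ X                 ≡⟨ cong (_∸ X) (sym (∑-geometric-/ (suc k) (suc n))) ⟩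
  (N ^ suc (suc n) ∸ N) / suc k ∸ X              ≡⟨ cong (λ e → (N ^ e ∸ N) / suc k ∸ X) (+-comm 2 n) ⟩
  (N ^ (n + 2) ∸ N) / suc k ∸ X                  ∎
  where
  open ≡-Reasoning
  open AboveDip k n₀
  X : ℕ
  X = N ^ 3 + N ^ 2 + 2 * N + 2
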